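{- Let $m,n\ge1$ and let $\mathcal{S}=[s_0,s_1,\ldots,s_{k-1}]$ be a binary $(mn,R)$-covering sequence of length $k$, where $n$ divides $k$. Let $M=k/n$ and let $\mathcal{A}'$ be the $M\times(2n-1)$ binary array whose $j$-th row, $0\le j\le M-1$, is $$s_{jn+1},s_{jn+2},\ldots,s_{jn+n},s_{jn+n+1},\ldots,s_{jn+2n-1},$$ with indices taken modulo $k$. Then $\mathcal{A}'$ is an $(m\times n,R)$-covering 2D-sequence.
   Context: A cyclic binary sequence of length $k$ has as its windows of length $N$ the words $(s_i,\ldots,s_{i+N-1})$, $0\le i\le k-1$, indices modulo $k$; it is an $(N,R)$-covering sequence if every $x\in\{0,1\}^N$ is within Hamming distance $R$ of some window. An $M\times N$ binary array $A=(A_{r,c})$ is regarded as doubly periodic (a torus); its $m\times n$ windows are the $m\times n$ arrays $(A_{(r+a)\bmod M,\,(c+b)\bmod N})_{0\le a<m,\,0\le b<n}$ for $0\le r<M$, $0\le c<N$. It is an $(m\times n,R)$-covering 2D-sequence if for every binary $m\times n$ matrix $B$ there is a window $X$ with $d(B,X)\le R$, where $d$ counts the entries in which two matrices differ. -}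

module Defs where

open import Data.Bool using (Bool; _xor_; if_then_else_)
open import Data.Nat using (ℕ; zero; suc; _+_; _*_; _∸_; _≤_; NonZero)
open import Data.Nat.DivMod using (_mod_; _/_)
open import Data.Fin using (Fin; toℕ) renaming (zero to fzero; suc to fsuc)
open import Data.Product using (∃-syntax; _×_)

Word : ℕ → Set
Word N = Fin N → Bool

Matrix : ℕ → ℕ → Set
Matrix m n = Fin m → Fin n → Bool

dist : {N : ℕ} → Word N → Word N → ℕ
dist {zero}  x y = 0
dist {suc N} x y = (if x fzero xor y fzero then 1 else 0) + dist (λ i → x (fsuc i)) (λ i → y (fsuc i))

dist2 : {m n : ℕ} → Matrix m n → Matrix m n → ℕ
dist2 {zero}  B X = 0
dist2 {suc m} B X = dist (B fzero) (X fzero) + dist2 (λ a → B (fsuc a)) (λ a → X (fsuc a))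

addMod : {M : ℕ} → Fin M → ℕ → Fin M
addMod {suc M} r a = (toℕ r + a) mod suc M

seqWindow : {k : ℕ} → (Fin k → Bool) → (N : ℕ) → Fin k → Word N
seqWindow s N i j = s (addMod i (toℕ j))

CoveringSeq : {k : ℕ} → (N R : ℕ) → (Fin k → Bool) → Set
CoveringSeq {k} N R s = (x : Word N) → ∃[ i ] (dist x (seqWindow s N i) ≤ R)

arrWindow : {M N : ℕ} → Matrix M N → (m n : ℕ) → Fin M → Fin N → Matrix m n
arrWindow A m n r c a b = A (addMod r (toℕ a)) (addMod c (toℕ b))

Covering2D : {M N : ℕ} → (m n R : ℕ) → Matrix M N → Set
Covering2D {M} {N} m n R A =
  (B : Matrix m n) → ∃[ r ] ∃[ c ] (dist2 B (arrWindow A m n r c) ≤ R)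

arrayA' : (n k : ℕ) → .{{_ : NonZero n}} → .{{_ : NonZero k}} →
          (Fin k → Bool) → Matrix (k / n) (2 * n ∸ 1)
arrayA' n k s j c = s ((toℕ j * n + 1 + toℕ c) mod k)

-- Read an m×n matrix B row by row as a word of length mn; this preserves Hamming distance.
-- The covering sequence has a window within distance R of that word, starting at some i.
-- Read row by row, that window is exactly the m×n window of A' at row (i − 1) div n and
-- column (i − 1) mod n: its entry (a, b) is s at index (r + a)n + 1 + c + b ≡ i + na + b
-- (mod k), and since c + b ≤ 2n − 2 the columns of A' never wrap around.
module Submission where

open import Defs
open import Data.Bool using (Bool; _xor_; if_then_else_)
open import Data.Nat using (ℕ; zero; suc; _+_; _*_; _∸_; _≤_; _<_; NonZero; >-nonZero⁻¹)
open import Data.Nat.Properties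
open import Data.Nat.DivMod
open import Data.Nat.Divisibility using (_∣_)
open import Data.Nat.Solver using (module +-*-Solver)
open import Data.Fin using (Fin; toℕ; fromℕ<; _↑ˡ_; _↑ʳ_; combine; remQuot) renaming (zero to fzero; suc to fsuc)
open import Data.Fin.Properties
  using (toℕ-fromℕ<; toℕ<n; toℕ-injective; toℕ-combine; combine-remQuot; remQuot-combine; splitAt-↑ʳ; nonZeroIndex)
open import Data.Product using (∃-syntax; _,_; proj₁; proj₂; uncurry)
open import Function using (_∘_)
open import Relation.Binary.PropositionalEquality

flatten : {m n : ℕ} → Matrix m n → Word (m * n)
flatten {n = n} B t = uncurry B (remQuot n t)

flatten-combine : ∀ {m n} (B : Matrix m n) a b → flatten B (combine a b) ≡ B a b
flatten-combine B a b = cong (uncurry B) (remQuot-combine a b)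

flatten-↑ʳ : ∀ {m n} (B : Matrix (suc m) n) (t : Fin (m * n)) →
             flatten B (n ↑ʳ t) ≡ flatten (B ∘ fsuc) t
flatten-↑ʳ {m} {n} B t rewrite splitAt-↑ʳ n (m * n) t = refl

dist-cong : ∀ {N} {x x′ y y′ : Word N} → x ≗ x′ → y ≗ y′ → dist x y ≡ dist x′ y′
dist-cong {zero}  x≗x′ y≗y′ = refl
dist-cong {suc N} x≗x′ y≗y′ =
  cong₂ _+_ (cong₂ (λ u v → if u xor v then 1 else 0) (x≗x′ fzero) (y≗y′ fzero))
            (dist-cong (x≗x′ ∘ fsuc) (y≗y′ ∘ fsuc))

dist-++ : ∀ n p (x y : Word (n + p)) →
          dist x y ≡ dist (x ∘ (_↑ˡ p)) (y ∘ (_↑ˡ p)) + dist (x ∘ (n ↑ʳ_)) (y ∘ (n ↑ʳ_))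
dist-++ zero    p x y = refl
dist-++ (suc n) p x y =
  trans (cong (d₀ +_) (dist-++ n p (x ∘ fsuc) (y ∘ fsuc))) (sym (+-assoc d₀ _ _))
  where d₀ = if x fzero xor y fzero then 1 else 0

dist2-flatten : ∀ {m n} (B X : Matrix m n) → dist2 B X ≡ dist (flatten B) (flatten X)
dist2-flatten {zero}      B X = refl
dist2-flatten {suc m} {n} B X = begin
  dist (B fzero) (X fzero) + dist2 (B ∘ fsuc) (X ∘ fsuc)
    ≡⟨ cong (dist (B fzero) (X fzero) +_) (dist2-flatten (B ∘ fsuc) (X ∘ fsuc)) ⟩
  dist (B fzero) (X fzero) + dist (flatten (B ∘ fsuc)) (flatten (X ∘ fsuc))
    ≡⟨ sym (cong₂ _+_ (dist-cong (flatten-combine B fzero) (flatten-combine X fzero))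
                      (dist-cong (flatten-↑ʳ B) (flatten-↑ʳ X))) ⟩
  dist (flatten B ∘ (_↑ˡ m * n)) (flatten X ∘ (_↑ˡ m * n))
    + dist (flatten B ∘ (n ↑ʳ_)) (flatten X ∘ (n ↑ʳ_))
    ≡⟨ sym (dist-++ n (m * n) (flatten B) (flatten X)) ⟩
  dist (flatten B) (flatten X) ∎
  where open ≡-Reasoning

[m%d+n]%d≡[m+n]%d : ∀ m n d .{{_ : NonZero d}} → (m % d + n) % d ≡ (m + n) % d
[m%d+n]%d≡[m+n]%d m n d = begin
  (m % d + n) % d          ≡⟨ %-distribˡ-+ (m % d) n d ⟩
  (m % d % d + n % d) % d  ≡⟨ cong (λ u → (u + n % d) % d) (m%n%n≡m%n m d) ⟩
  (m % d + n % d) % d      ≡⟨ sym (%-distribˡ-+ m n d) ⟩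
  (m + n) % d              ∎
  where open ≡-Reasoning

-- (i + K) % suc K is the predecessor of i modulo suc K.
[[i+K]%[1+K]+1+t]%[1+K] : ∀ K i t → ((i + K) % suc K + suc t) % suc K ≡ (i + t) % suc K
[[i+K]%[1+K]+1+t]%[1+K] K i t = begin
  ((i + K) % suc K + suc t) % suc K  ≡⟨ [m%d+n]%d≡[m+n]%d (i + K) (suc t) (suc K) ⟩
  (i + K + suc t) % suc K            ≡⟨ cong (_% suc K) (solve 3 (λ i K t →
                                          i :+ K :+ (con 1 :+ t) := i :+ t :+ (con 1 :+ K)) refl i K t) ⟩
  (i + t + suc K) % suc K            ≡⟨ [m+n]%n≡m%n (i + t) (suc K) ⟩
  (i + t) % suc K                    ∎
  where open ≡-Reasoning; open +-*-Solver

row-major-shift : ∀ {M n k} .{{_ : NonZero M}} .{{_ : NonZero n}} .{{_ : NonZero k}} →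
                  M * n ≡ k → ∀ j a b →
                  ((j / n + a) % M * n + 1 + (j % n + b)) % k ≡ (j + suc (n * a + b)) % k
row-major-shift {M} {n} refl j a b = begin
  ((q + a) % M * n + 1 + (x + b)) % (M * n)
    ≡⟨ cong (λ u → (u + 1 + (x + b)) % (M * n)) (m%n*o≡m*o%[n*o] (q + a) M n) ⟩
  ((q + a) * n % (M * n) + 1 + (x + b)) % (M * n)
    ≡⟨ cong (_% (M * n)) (+-assoc ((q + a) * n % (M * n)) 1 (x + b)) ⟩
  ((q + a) * n % (M * n) + suc (x + b)) % (M * n)
    ≡⟨ [m%d+n]%d≡[m+n]%d ((q + a) * n) (suc (x + b)) (M * n) ⟩
  ((q + a) * n + suc (x + b)) % (M * n)
    ≡⟨ cong (_% (M * n)) (solve 5 (λ n q a x b →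
         (q :+ a) :* n :+ (con 1 :+ (x :+ b)) := x :+ q :* n :+ (con 1 :+ (n :* a :+ b))) refl n q a x b) ⟩
  (x + q * n + suc (n * a + b)) % (M * n)
    ≡⟨ cong (λ u → (u + suc (n * a + b)) % (M * n)) (sym (m≡m%n+[m/n]*n j n)) ⟩
  (j + suc (n * a + b)) % (M * n) ∎
  where
  open ≡-Reasoning; open +-*-Solver
  q = j / n
  x = j % n

residue-sum<2n∸1 : ∀ {x y n} → x < n → y < n → x + y < 2 * n ∸ 1
residue-sum<2n∸1 {x} {y} {n} x<n y<n = m+n≤o⇒m≤o∸n (suc (x + y)) (begin
  suc (x + y) + 1    ≡⟨ +-comm (suc (x + y)) 1 ⟩
  suc (suc (x + y))  ≡⟨ cong suc (sym (+-suc x y)) ⟩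
  suc x + suc y      ≤⟨ +-mono-≤ x<n y<n ⟩
  n + n              ≡⟨ cong (n +_) (sym (+-identityʳ n)) ⟩
  2 * n              ∎)
  where open ≤-Reasoning

toℕ-addMod : ∀ {M} .{{_ : NonZero M}} (r : Fin M) u → toℕ (addMod r u) ≡ (toℕ r + u) % M
toℕ-addMod {suc M} r u = toℕ-fromℕ< _

shiftedRows : ∀ {M N} (n k : ℕ) .{{_ : NonZero k}} → (Fin k → Bool) → Matrix M N
shiftedRows n k s j c = s ((toℕ j * n + 1 + toℕ c) mod k)

seqWindow≗flatten-arrWindow :
  ∀ {m n k M N} .{{_ : NonZero n}} .{{_ : NonZero k}} → M * n ≡ k → 2 * n ∸ 1 ≤ N →
  (s : Fin k → Bool) (i : Fin k) →
  ∃[ r ] ∃[ c ] flatten (arrWindow (shiftedRows {M} {N} n k s) m n r c) ≗ seqWindow s (m * n) i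
seqWindow≗flatten-arrWindow {k = zero} _ _ _ ()
seqWindow≗flatten-arrWindow {m} {n} {suc K} {M} {N} Mn≡k 2n∸1≤N s i = r , c , window≗
  where
  open ≡-Reasoning
  j = (toℕ i + K) % suc K
  r : Fin M
  r = fromℕ< (m<n*o⇒m/o<n {n = M} (subst (j <_) (sym Mn≡k) (m%n<n (toℕ i + K) (suc K))))
  column< : ∀ {b} → b < n → j % n + b < N
  column< b<n = <-≤-trans (residue-sum<2n∸1 (m%n<n j n) b<n) 2n∸1≤N
  c : Fin N
  c = fromℕ< (subst (_< N) (+-identityʳ (j % n)) (column< (>-nonZero⁻¹ n)))
  instance
    _ = nonZeroIndex r
    _ = nonZeroIndex c
  W = arrWindow (shiftedRows {M} {N} n (suc K) s) m n r c
  row : ∀ a → toℕ (addMod r a) ≡ (j / n + a) % M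
  row a = trans (toℕ-addMod r a) (cong (λ u → (u + a) % M) (toℕ-fromℕ< _))
  column : ∀ {b} → b < n → toℕ (addMod c b) ≡ j % n + b
  column {b} b<n = begin
    toℕ (addMod c b)  ≡⟨ toℕ-addMod c b ⟩
    (toℕ c + b) % N   ≡⟨ cong (λ u → (u + b) % N) (toℕ-fromℕ< _) ⟩
    (j % n + b) % N   ≡⟨ m<n⇒m%n≡m (column< b<n) ⟩
    j % n + b         ∎
  index : ∀ a b → (toℕ (addMod r (toℕ a)) * n + 1 + toℕ (addMod c (toℕ b))) % suc K
                ≡ (toℕ i + toℕ (combine a b)) % suc K
  index a b = begin
    (toℕ (addMod r (toℕ a)) * n + 1 + toℕ (addMod c (toℕ b))) % suc K
      ≡⟨ cong₂ (λ u v → (u * n + 1 + v) % suc K) (row (toℕ a)) (column (toℕ<n b)) ⟩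
    ((j / n + toℕ a) % M * n + 1 + (j % n + toℕ b)) % suc K
      ≡⟨ row-major-shift {M} Mn≡k j (toℕ a) (toℕ b) ⟩
    (j + suc (n * toℕ a + toℕ b)) % suc K
      ≡⟨ [[i+K]%[1+K]+1+t]%[1+K] K (toℕ i) (n * toℕ a + toℕ b) ⟩
    (toℕ i + (n * toℕ a + toℕ b)) % suc K
      ≡⟨ cong (λ u → (toℕ i + u) % suc K) (sym (toℕ-combine a b)) ⟩
    (toℕ i + toℕ (combine a b)) % suc K ∎
  entry : ∀ a b → W a b ≡ seqWindow s (m * n) i (combine a b)
  entry a b = cong s (toℕ-injective (trans (toℕ-fromℕ< _) (trans (index a b) (sym (toℕ-fromℕ< _)))))
  window≗ : flatten W ≗ seqWindow s (m * n) i
  window≗ t = trans (entry a b) (cong (seqWindow s (m * n) i) (combine-remQuot {m} n t))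
    where
    a = proj₁ (remQuot {m} n t)
    b = proj₂ (remQuot {m} n t)

shiftedRows-covering :
  ∀ {m n k M N R} .{{_ : NonZero n}} .{{_ : NonZero k}} → M * n ≡ k → 2 * n ∸ 1 ≤ N →
  (s : Fin k → Bool) → CoveringSeq (m * n) R s → Covering2D m n R (shiftedRows {M} {N} n k s)
shiftedRows-covering {m} {n} {k} {M} {N} {R} Mn≡k 2n∸1≤N s cover B with cover (flatten B)
... | i , close with seqWindow≗flatten-arrWindow {m} {n} {k} {M} {N} Mn≡k 2n∸1≤N s i
... | r , c , window≗ = r , c , (begin
  dist2 B (arrWindow A m n r c)                    ≡⟨ dist2-flatten B _ ⟩
  dist (flatten B) (flatten (arrWindow A m n r c)) ≡⟨ dist-cong (λ _ → refl) window≗ ⟩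
  dist (flatten B) (seqWindow s (m * n) i)         ≤⟨ close ⟩
  R                                                ∎)
  where
  open ≤-Reasoning
  A = shiftedRows {M} {N} n k s

theorem6 : (m n k R : ℕ) → .{{_ : NonZero m}} → .{{_ : NonZero n}} → .{{_ : NonZero k}} →
           n ∣ k → (s : Fin k → Bool) → CoveringSeq (m * n) R s →
           Covering2D m n R (arrayA' n k s)
theorem6 m n k R n∣k s = shiftedRows-covering (m/n*n≡m n∣k) ≤-refl s
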